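{- Let $A=I^n_c/L$ be a chromotopology, where $L\subseteq\mathbf{Z}_2^n$ is a code, and let $i\in[n]$. Then the color $i$ decomposes $A$ (i.e. removing all edges of color $i$ splits $A$ into exactly two connected components) if and only if every codeword of $L$ has $i$-th bit equal to $0$.
   Context: $I^n_c/L$ is the edge-colored graph with vertex set $\mathbf{Z}_2^n/L$ having, for each coset $C$ and each color $j\in[n]$, an edge of color $j$ joining $C$ and $C+e_j$ ($e_j$ the $j$-th standard basis vector). A chromotopology of dimension $n$ is a finite connected simple bipartite $n$-regular graph with edges colored by $[n]$, each vertex incident to exactly one edge of each color, such that for distinct colors $j,l$ the edges of colors $j,l$ form a disjoint union of $4$-cycles. -}

module Defs where

open import Data.Bool using (Bool; true; false; _xor_)
open import Data.Nat using (ℕ)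
open import Data.Fin using (Fin)
open import Data.Vec using (Vec; replicate; zipWith; _[_]≔_)
open import Data.Product using (Σ; ∃; _×_; _,_)
open import Data.Sum using (_⊎_)
open import Data.Unit using (⊤)
open import Relation.Nullary using (¬_)
open import Relation.Binary.PropositionalEquality using (_≡_; _≢_)
open import Relation.Binary.Construct.Closure.ReflexiveTransitive using (Star)

Word : ℕ → Set
Word n = Vec Bool n

_⊕_ : ∀ {n} → Word n → Word n → Word n
_⊕_ = zipWith _xor_

0ʷ : ∀ {n} → Word n
0ʷ = replicate _ false

e : ∀ {n} → Fin n → Word n
e j = replicate _ false [ j ]≔ true

record IsLinearCode {n : ℕ} (L : Word n → Set) : Set where
  field
    zero∈ : L 0ʷ
    ⊕-closed : ∀ {x y} → L x → L y → L (x ⊕ y)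

-- Edge-coloured graphs (colours in Fin n), vertices given with an
-- equality relation _≈_ (needed since vertices of I^n_c/L are cosets),
-- Edge j x y : there is an edge of colour j joining x and y.

record ColouredGraph (n : ℕ) : Set₁ where
  field
    V    : Set
    _≈_  : V → V → Set
    Edge : Fin n → V → V → Set

module _ {n : ℕ} (G : ColouredGraph n) where
  open ColouredGraph G

  AdjBy : (Fin n → Set) → V → V → Set
  AdjBy P x y = ∃ λ j → P j × Edge j x y

  Adj : V → V → Set
  Adj = AdjBy (λ _ → ⊤)

  Connected-in : (Fin n → Set) → V → V → Set
  Connected-in P x y = Star (λ a b → a ≈ b ⊎ AdjBy P a b) x y

  record IsChromotopology : Set where
    field
      connected : ∀ x y → Connected-in (λ _ → ⊤) x y
      noLoops   : ∀ j x → ¬ Edge j x x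
      noMulti   : ∀ {j k x y} → Edge j x y → Edge k x y → j ≡ k
      bipartite : Σ (V → Bool) λ f →
                    (∀ {x y} → x ≈ y → f x ≡ f y) ×
                    (∀ {j x y} → Edge j x y → f x ≢ f y)
      oneEdge   : ∀ x j → Σ V λ y → Edge j x y × (∀ {y'} → Edge j x y' → y' ≈ y)
      -- for distinct colours j, l the j,l-edges form disjoint 4-cycles:
      -- every vertex x lies on an alternating 4-cycle x -j- a -l- b -j- c -l- x
      -- with four distinct vertices
      fourCycles : ∀ {j l} → j ≢ l → ∀ x → Σ V λ a → Σ V λ b → Σ V λ c →
                     Edge j x a × Edge l a b × Edge j b c × Edge l c x ×
                     ¬ (x ≈ a) × ¬ (x ≈ b) × ¬ (x ≈ c) ×
                     ¬ (a ≈ b) × ¬ (a ≈ c) × ¬ (b ≈ c)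

  Decomposes : Fin n → Set
  Decomposes i = Σ V λ x → Σ V λ y →
                   ¬ Connected-in (λ j → j ≢ i) x y ×
                   (∀ z → Connected-in (λ j → j ≢ i) z x ⊎ Connected-in (λ j → j ≢ i) z y)

-- The quotient cube I^n_c / L: vertices are words, identified modulo L
-- (x ≈ y iff x + y ∈ L, i.e. same coset); coset C is joined by an edge of
-- colour j to C + e_j.

cubeQuotient : ∀ {n} (L : Word n → Set) → ColouredGraph n
cubeQuotient {n} L = record
  { V    = Word n
  ; _≈_  = λ x y → L (x ⊕ y)
  ; Edge = λ j x y → L ((x ⊕ e j) ⊕ y)
  }

-- Flipping single coordinates connects any two words of Z_2^n, and flipping
-- only coordinates other than i connects any two words with the same i-th bit.
-- In I^n_c/L a walk may in addition jump by a codeword.  If no codeword has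
-- i-th bit 1, the i-th bit is invariant along walks avoiding colour i, and its
-- two values are the two components.  If some codeword c has c_i = 1, then any
-- x reaches y + c ≈ y without using colour i, so removing colour i leaves A
-- connected.
module Submission where

open import Defs
open import Data.Bool using (true; false; not; _xor_)
open import Data.Bool.Properties using (¬-not; xor-comm; true-xor; xor-same; xor-identityʳ; xor-assoc)
  renaming (_≟_ to _≟ᵇ_)
open import Data.Nat using (ℕ; suc)
open import Data.Fin using (Fin; zero; suc)
open import Data.Vec using ([]; _∷_; lookup; replicate)
open import Data.Vec.Properties
  using (lookup-zipWith; lookup-replicate; lookup∘update; lookup∘update′; zipWith-assoc; zipWith-comm; zipWith-identityʳ)
open import Data.Product using (∃; _×_; _,_)
open import Data.Sum using (_⊎_; inj₁; inj₂)
open import Data.Empty using (⊥-elim)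
open import Function using (_∘_; id)
open import Function.Bundles using (_⇔_; mk⇔)
open import Relation.Nullary using (¬_; yes; no)
open import Relation.Binary.PropositionalEquality
  using (_≡_; _≢_; refl; sym; trans; cong; cong₂; subst; module ≡-Reasoning)
open import Relation.Binary.Construct.Closure.ReflexiveTransitive using (Star; ε; _◅_; _◅◅_; gmap; fold)

⊕-self : ∀ {n} (x : Word n) → x ⊕ x ≡ 0ʷ
⊕-self []      = refl
⊕-self (b ∷ x) = cong₂ _∷_ (xor-same b) (⊕-self x)

module _ {n : ℕ} where

  ⊕-assoc : (x y z : Word n) → (x ⊕ y) ⊕ z ≡ x ⊕ (y ⊕ z)
  ⊕-assoc = zipWith-assoc xor-assoc

  ⊕-comm : (x y : Word n) → x ⊕ y ≡ y ⊕ x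
  ⊕-comm = zipWith-comm xor-comm

  ⊕-identityʳ : (x : Word n) → x ⊕ 0ʷ ≡ x
  ⊕-identityʳ = zipWith-identityʳ xor-identityʳ

  ⊕-cancelˡ : (y c : Word n) → (y ⊕ c) ⊕ y ≡ c
  ⊕-cancelˡ y c = begin
    (y ⊕ c) ⊕ y  ≡⟨ cong (_⊕ y) (⊕-comm y c) ⟩
    (c ⊕ y) ⊕ y  ≡⟨ ⊕-assoc c y y ⟩
    c ⊕ (y ⊕ y)  ≡⟨ cong (c ⊕_) (⊕-self y) ⟩
    c ⊕ 0ʷ       ≡⟨ ⊕-identityʳ c ⟩
    c            ∎
    where open ≡-Reasoning

  lookup-⊕ : (x y : Word n) (i : Fin n) → lookup (x ⊕ y) i ≡ lookup x i xor lookup y i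
  lookup-⊕ x y i = lookup-zipWith _xor_ i x y

  lookup-0ʷ : (i : Fin n) → lookup (0ʷ {n}) i ≡ false
  lookup-0ʷ i = lookup-replicate i false

  lookup-e-self : (i : Fin n) → lookup (e i) i ≡ true
  lookup-e-self i = lookup∘update i (replicate n false) true

  lookup-e-≢ : {j i : Fin n} → j ≢ i → lookup (e j) i ≡ false
  lookup-e-≢ {j} {i} j≢i = trans (lookup∘update′ (j≢i ∘ sym) (replicate n false) true) (lookup-0ʷ i)

  lookup-⊕-e-≢ : (x : Word n) {j i : Fin n} → j ≢ i → lookup (x ⊕ e j) i ≡ lookup x i
  lookup-⊕-e-≢ x {j} {i} j≢i = begin
    lookup (x ⊕ e j) i             ≡⟨ lookup-⊕ x (e j) i ⟩
    lookup x i xor lookup (e j) i  ≡⟨ cong (lookup x i xor_) (lookup-e-≢ j≢i) ⟩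
    lookup x i xor false           ≡⟨ xor-identityʳ (lookup x i) ⟩
    lookup x i                     ∎
    where open ≡-Reasoning

  lookup-⊕-true : (x c : Word n) {i : Fin n} → lookup c i ≡ true → lookup (x ⊕ c) i ≡ not (lookup x i)
  lookup-⊕-true x c {i} cᵢ≡true = begin
    lookup (x ⊕ c) i           ≡⟨ lookup-⊕ x c i ⟩
    lookup x i xor lookup c i  ≡⟨ cong (lookup x i xor_) cᵢ≡true ⟩
    lookup x i xor true        ≡⟨ xor-comm (lookup x i) true ⟩
    true xor lookup x i        ≡⟨ true-xor (lookup x i) ⟩
    not (lookup x i)           ∎
    where open ≡-Reasoning

xor≡false⇒≡ : ∀ a b → a xor b ≡ false → a ≡ b
xor≡false⇒≡ true  true  _ = refl
xor≡false⇒≡ false false _ = refl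

Flip : ∀ {n} → (Fin n → Set) → Word n → Word n → Set
Flip P x y = ∃ λ j → P j × y ≡ x ⊕ e j

flips-∷ : ∀ {n} {P : Fin (suc n) → Set} b {x y : Word n} →
          Star (Flip (P ∘ suc)) x y → Star (Flip P) (b ∷ x) (b ∷ y)
flips-∷ b = gmap (b ∷_) λ { (j , p , y≡x⊕eⱼ) → suc j , p , cong₂ _∷_ (sym (xor-identityʳ b)) y≡x⊕eⱼ }

flip-head : ∀ {n} {P : Fin (suc n) → Set} b c (x : Word n) →
            (b ≢ c → P zero) → Star (Flip P) (b ∷ x) (c ∷ x)
flip-head true  true  x _       = ε
flip-head false false x _       = ε
flip-head true  false x allowed = (zero , allowed (λ ()) , cong (false ∷_) (sym (⊕-identityʳ x))) ◅ ε
flip-head false true  x allowed = (zero , allowed (λ ()) , cong (true ∷_) (sym (⊕-identityʳ x))) ◅ ε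

flips-connect : ∀ {n} {P : Fin n → Set} (x y : Word n) →
                (∀ j → lookup x j ≢ lookup y j → P j) → Star (Flip P) x y
flips-connect []      []      _       = ε
flips-connect (b ∷ x) (c ∷ y) allowed =
  flips-∷ b (flips-connect x y (allowed ∘ suc)) ◅◅ flip-head b c y (allowed zero)

module _ {n : ℕ} {L : Word n → Set} where

  Connected-avoiding : Fin n → Word n → Word n → Set
  Connected-avoiding i = Connected-in (cubeQuotient L) (_≢ i)

  flips⇒connected : L 0ʷ → ∀ {P : Fin n → Set} {x y} → Star (Flip P) x y → Connected-in (cubeQuotient L) P x y
  flips⇒connected 0∈L = gmap id λ { (j , p , refl) → inj₂ (j , p , subst L (sym (⊕-self _)) 0∈L) }

  sameBit⇒connected : L 0ʷ → (i : Fin n) (x y : Word n) → lookup x i ≡ lookup y i → Connected-avoiding i x y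
  sameBit⇒connected 0∈L i x y xᵢ≡yᵢ = flips⇒connected 0∈L (flips-connect x y λ { j xⱼ≢yⱼ refl → xⱼ≢yⱼ xᵢ≡yᵢ })

  codewordBit⇒connected : L 0ʷ → ∀ {c} i → L c → lookup c i ≡ true → ∀ x y → Connected-avoiding i x y
  codewordBit⇒connected 0∈L {c} i c∈L cᵢ≡true x y with lookup x i ≟ᵇ lookup y i
  ... | yes xᵢ≡yᵢ = sameBit⇒connected 0∈L i x y xᵢ≡yᵢ
  ... | no  xᵢ≢yᵢ =
    sameBit⇒connected 0∈L i x (y ⊕ c) (trans (¬-not xᵢ≢yᵢ) (sym (lookup-⊕-true y c cᵢ≡true)))
      ◅◅ inj₁ (subst L (sym (⊕-cancelˡ y c)) c∈L) ◅ ε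

  module _ (i : Fin n) (bitZero : ∀ c → L c → lookup c i ≡ false) where

    ≈⇒sameBit : ∀ {x y} → L (x ⊕ y) → lookup x i ≡ lookup y i
    ≈⇒sameBit {x} {y} x⊕y∈L = xor≡false⇒≡ _ _ (trans (sym (lookup-⊕ x y i)) (bitZero _ x⊕y∈L))

    connected⇒sameBit : ∀ {x y} → Connected-avoiding i x y → lookup x i ≡ lookup y i
    connected⇒sameBit = fold (λ x y → lookup x i ≡ lookup y i) (trans ∘ step) refl
      where
      step : ∀ {x y} → L (x ⊕ y) ⊎ AdjBy (cubeQuotient L) (_≢ i) x y → lookup x i ≡ lookup y i
      step (inj₁ x≈y)                  = ≈⇒sameBit x≈y
      step {x} (inj₂ (j , j≢i , x~ⱼy)) = trans (sym (lookup-⊕-e-≢ x j≢i)) (≈⇒sameBit x~ⱼy)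

  decomposes⇒bitZero : L 0ʷ → ∀ i → Decomposes (cubeQuotient L) i → ∀ c → L c → lookup c i ≡ false
  decomposes⇒bitZero 0∈L i (x , y , x≁y , _) c c∈L with lookup c i in cᵢ
  ... | false = refl
  ... | true  = ⊥-elim (x≁y (codewordBit⇒connected 0∈L i c∈L cᵢ x y))

  bitZero⇒decomposes : L 0ʷ → ∀ i → (∀ c → L c → lookup c i ≡ false) → Decomposes (cubeQuotient L) i
  bitZero⇒decomposes 0∈L i bitZero = 0ʷ , e i , separated , cover
    where
    separated : ¬ Connected-avoiding i 0ʷ (e i)
    separated walk with trans (sym (lookup-0ʷ i)) (trans (connected⇒sameBit i bitZero walk) (lookup-e-self i))
    ... | ()

    cover : ∀ z → Connected-avoiding i z 0ʷ ⊎ Connected-avoiding i z (e i)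
    cover z with lookup z i in zᵢ
    ... | false = inj₁ (sameBit⇒connected 0∈L i z 0ʷ (trans zᵢ (sym (lookup-0ʷ i))))
    ... | true  = inj₂ (sameBit⇒connected 0∈L i z (e i) (trans zᵢ (sym (lookup-e-self i))))

mainTheorem13 : ∀ {n} (L : Word n → Set) → IsLinearCode L →
                  IsChromotopology (cubeQuotient L) → (i : Fin n) →
                  Decomposes (cubeQuotient L) i ⇔ (∀ c → L c → lookup c i ≡ false)
mainTheorem13 L code _ i = mk⇔ (decomposes⇒bitZero 0∈L i) (bitZero⇒decomposes 0∈L i)
  where open IsLinearCode code renaming (zero∈ to 0∈L)
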